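{- Let $n\ge 3$ and let $L^B$ be a blow-up of the Boolean lattice $L\cong\mathbf{2}^n$. Then $G^c(L^B)_{SR}$ is a connected graph and $\operatorname{diam}(G^c(L^B)_{SR})\le 3$.
   Context: Blow-up: let $L=\mathbf{2}^n$. A blow-up $L^B$ is obtained by replacing each $a\in L\setminus\{0,1\}$ by a finite nonempty chain $C_a$ (possibly a single element), keeping $0,1$; order: $x\le y$ iff $x=0$, or $y=1$, or $x,y$ lie in the same chain $C_a$ with $x\le y$ there, or $x\in C_a$, $y\in C_b$ with $a<b$ in $L$; this is a lattice. For a lattice $M$ with $0$: $Z^*(M)$ is the set of nonzero $a$ with $a\wedge b=0$ for some $b\ne0$; $G^c(M)$ is the graph on $Z^*(M)$ with distinct $a,b$ adjacent iff $a\wedge b\neq 0$. In a connected graph $G$, $u$ is maximally distant from $v$ if $d(v,w)\le d(u,v)$ for every neighbor $w$ of $u$; $u,v$ are mutually maximally distant if each is maximally distant from the other; $\partial(G)$ is the set of vertices mutually maximally distant from some vertex; the strong resolving graph $G_{SR}$ has vertex set $\partial(G)$ with distinct $u,v$ adjacent iff mutually maximally distant in $G$. -}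

module Defs where

open import Data.Nat using (ℕ; zero; suc; _≤_)
open import Data.Fin using (Fin; toℕ)
open import Data.Bool using (Bool)
import Data.Bool as B
open import Data.Fin.Subset using (Subset; _⊂_) renaming (⊥ to ∅; ⊤ to full)
open import Data.Vec.Properties using (≡-dec)
open import Data.Product using (Σ; ∃; _×_)
open import Data.Sum using (_⊎_)
open import Relation.Nullary using (¬_; ¬?)
open import Relation.Nullary.Decidable using (True)
open import Relation.Binary.PropositionalEquality using (_≡_; _≢_)

-- An element a of L = 2^n (subsets of Fin n) different from 0 = ∅ and 1 = full.
-- Stated as a decidable (hence proof-irrelevant, unit-like) predicate.
Proper : {n : ℕ} → Subset n → Set
Proper a = True (¬? (≡-dec B._≟_ a ∅)) × True (¬? (≡-dec B._≟_ a full))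

-- The blow-up L^B of L = 2^n determined by chain sizes: the chain C_a
-- replacing a ∈ L ∖ {0,1} has  suc (k a)  elements (finite, nonempty).
data BlowUp (n : ℕ) (k : Subset n → ℕ) : Set where
  bot : BlowUp n k
  top : BlowUp n k
  mid : (a : Subset n) → Proper a → Fin (suc (k a)) → BlowUp n k

data _≤B_ {n : ℕ} {k : Subset n → ℕ} : BlowUp n k → BlowUp n k → Set where
  bot≤ : ∀ {y} → bot ≤B y
  ≤top : ∀ {x} → x ≤B top
  chain≤ : ∀ {a p q i j} → toℕ i ≤ toℕ j → mid a p i ≤B mid a q j
  lower≤ : ∀ {a b p q i j} → a ⊂ b → mid a p i ≤B mid b q j

-- x ∧ y = 0 : every common lower bound of x and y is 0
-- (the meet is the greatest lower bound, L^B being a lattice).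
MeetZero : {n : ℕ} {k : Subset n → ℕ} → BlowUp n k → BlowUp n k → Set
MeetZero {n} {k} x y = ∀ (z : BlowUp n k) → z ≤B x → z ≤B y → z ≡ bot

Zstar : {n : ℕ} {k : Subset n → ℕ} → BlowUp n k → Set
Zstar {n} {k} x = x ≢ bot × Σ (BlowUp n k) (λ y → y ≢ bot × MeetZero x y)

AdjGc : {n : ℕ} {k : Subset n → ℕ} → BlowUp n k → BlowUp n k → Set
AdjGc x y = Zstar x × Zstar y × x ≢ y × ¬ MeetZero x y

data Walk {A : Set} (adj : A → A → Set) : A → A → ℕ → Set where
  here : ∀ {x} → Walk adj x x zero
  step : ∀ {x y z m} → adj x y → Walk adj y z m → Walk adj x z (suc m)

Dist : {A : Set} (adj : A → A → Set) → A → A → ℕ → Set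
Dist adj x y m = Walk adj x y m × (∀ m' → Walk adj x y m' → m ≤ m')

MaxDist : {A : Set} (adj : A → A → Set) → A → A → Set
MaxDist adj u v = ∀ w → adj u w → ∀ d e → Dist adj u v d → Dist adj v w e → e ≤ d

MMD : {A : Set} (adj : A → A → Set) → A → A → Set
MMD adj u v = MaxDist adj u v × MaxDist adj v u

VertGc : {n : ℕ} {k : Subset n → ℕ} → BlowUp n k → Set
VertGc = Zstar

Boundary : {n : ℕ} {k : Subset n → ℕ} → BlowUp n k → Set
Boundary {n} {k} u =
  Zstar u × Σ (BlowUp n k) (λ v → Zstar v × MMD AdjGc u v)

AdjSR : {n : ℕ} {k : Subset n → ℕ} → BlowUp n k → BlowUp n k → Set
AdjSR u v = Boundary u × Boundary v × u ≢ v × MMD AdjGc u v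

-- Regard a vertex of G^c(L^B) as an element of a chain C_a with support a;
-- two vertices have nonzero meet iff their supports intersect. Vertices with
-- disjoint supports are at distance exactly 2, and for n ≥ 3 every neighbour w
-- of one is within distance 2 of the other (via the two-point set made of a
-- point of the other's support and a point shared with w). So they are mutually
-- maximally distant, i.e. adjacent in the strong resolving graph; in particular
-- every vertex lies in ∂. For supports a, b: if a ∩ b = ∅ the vertices are
-- adjacent; if some point r lies outside a ∪ b, both are adjacent to the atom
-- {r}; otherwise ∁a and ∁b are disjoint and a, ∁a, ∁b, b is a path.
module Submission where

open import Defs
open import Data.Nat using (ℕ; _≤_; z≤n; s≤s)
open import Data.Nat.Properties using (≤-trans; ≤-refl)
open import Data.Fin using (Fin; zero; suc)
open import Data.Fin.Properties using (any?; ¬∀⟶∃¬)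
open import Data.Fin.Subset
  using (Subset; _∈_; _∉_; _⊆_; _⊂_; ⁅_⁆; _∪_; _∩_; ∁; Nonempty)
  renaming (⊥ to ∅; ⊤ to full)
open import Data.Fin.Subset.Properties
  using (_∈?_; ⊆-antisym; ⊆⊤; ∉⊥; ∈⊤; x∈⁅x⁆; x∈⁅y⁆⇒x≡y; x∈p∪q⁺; x∈p∪q⁻;
         x∈p∩q⁺; x≢y⇒x∉⁅y⁆; p∩q⊆p; p∩q⊆q; x∈p⇒x∉∁p; x∈∁p⇒x∉p; x∉p⇒x∈∁p)
open import Data.Product using (Σ; ∃; _×_; _,_)
open import Data.Sum using (_⊎_; inj₁; inj₂; [_,_])
open import Data.Empty using (⊥-elim)
open import Function using (_∘_; id)
import Data.Bool as B
open import Data.Vec.Properties using (≡-dec)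
open import Relation.Nullary using (¬_; yes; no; ¬?)
open import Relation.Nullary.Decidable using (toWitness; fromWitness; _×-dec_; decidable-stable)
open import Relation.Binary.PropositionalEquality using (_≡_; _≢_; refl; sym; subst)

maxDist-if-neighbours-within : ∀ {A : Set} {adj : A → A → Set} {u v : A} m →
  (∀ d → Walk adj u v d → m ≤ d) →
  (∀ w → adj u w → Σ ℕ λ l → l ≤ m × Walk adj v w l) →
  MaxDist adj u v
maxDist-if-neighbours-within m far near w u~w d e (u⇝v , _) (_ , minimal) =
  let l , l≤m , v⇝w = near w u~w in
  ≤-trans (minimal l v⇝w) (≤-trans l≤m (far d u⇝v))

∃≢₂ : ∀ {m} → 3 ≤ m → (x y : Fin m) → ∃ λ z → z ≢ x × z ≢ y
∃≢₂ (s≤s (s≤s (s≤s _))) zero          zero          = suc zero , (λ ()) , (λ ())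
∃≢₂ (s≤s (s≤s (s≤s _))) zero          (suc zero)    = suc (suc zero) , (λ ()) , (λ ())
∃≢₂ (s≤s (s≤s (s≤s _))) zero          (suc (suc _)) = suc zero , (λ ()) , (λ ())
∃≢₂ (s≤s (s≤s (s≤s _))) (suc zero)    zero          = suc (suc zero) , (λ ()) , (λ ())
∃≢₂ (s≤s (s≤s (s≤s _))) (suc zero)    (suc _)       = zero , (λ ()) , (λ ())
∃≢₂ (s≤s (s≤s (s≤s _))) (suc (suc _)) zero          = suc zero , (λ ()) , (λ ())
∃≢₂ (s≤s (s≤s (s≤s _))) (suc (suc _)) (suc _)       = zero , (λ ()) , (λ ())

module _ {n : ℕ} where

  Disjoint : Subset n → Subset n → Set
  Disjoint p q = ∀ {x} → x ∈ p → x ∉ q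

  ∈∧∉⇒≢ : ∀ {x} {p q : Subset n} → x ∈ p → x ∉ q → p ≢ q
  ∈∧∉⇒≢ x∈p x∉q refl = x∉q x∈p

  Disjoint-sym : ∀ {p q} → Disjoint p q → Disjoint q p
  Disjoint-sym p#q x∈q x∈p = p#q x∈p x∈q

  Disjoint-∁ : ∀ {p} → Disjoint p (∁ p)
  Disjoint-∁ x∈p x∈∁p = x∈∁p⇒x∉p x∈∁p x∈p

  ∉⇒Disjoint-⁅⁆ : ∀ {x p} → x ∉ p → Disjoint ⁅ x ⁆ p
  ∉⇒Disjoint-⁅⁆ {x} {p} x∉p y∈⁅x⁆ = subst (_∉ p) (sym (x∈⁅y⁆⇒x≡y x y∈⁅x⁆)) x∉p

  intersect-or-disjoint : ∀ p q → (∃ λ x → x ∈ p × x ∈ q) ⊎ Disjoint p q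
  intersect-or-disjoint p q with any? (λ x → (x ∈? p) ×-dec (x ∈? q))
  ... | yes common = inj₁ common
  ... | no ¬common = inj₂ (λ {x} x∈p x∈q → ¬common (x , x∈p , x∈q))

  ⊆∧≢⇒⊂ : ∀ {p q : Subset n} → p ⊆ q → p ≢ q → p ⊂ q
  ⊆∧≢⇒⊂ {p} {q} p⊆q p≢q with any? (λ x → (x ∈? q) ×-dec ¬? (x ∈? p))
  ... | yes (x , x∈q , x∉p) = p⊆q , x , x∈q , x∉p
  ... | no ¬new = ⊥-elim (p≢q (⊆-antisym p⊆q
          (λ {x} x∈q → decidable-stable (x ∈? p) (λ x∉p → ¬new (x , x∈q , x∉p)))))

  ≢full⇒∃∉ : ∀ {p : Subset n} → p ≢ full → ∃ (_∉ p)
  ≢full⇒∃∉ {p} p≢full =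
    ¬∀⟶∃¬ n (_∈ p) (_∈? p) (λ all → p≢full (⊆-antisym ⊆⊤ (λ {x} _ → all x)))

  ≢∅⇒Nonempty : ∀ {p : Subset n} → p ≢ ∅ → Nonempty p
  ≢∅⇒Nonempty {p} p≢∅ with any? (_∈? p)
  ... | yes nonempty = nonempty
  ... | no empty = ⊥-elim (p≢∅ (⊆-antisym (λ {x} x∈p → ⊥-elim (empty (x , x∈p))) (⊥-elim ∘ ∉⊥)))

  ∈∧∉⇒Proper : ∀ {x y} {p : Subset n} → x ∈ p → y ∉ p → Proper p
  ∈∧∉⇒Proper x∈p y∉p =
    fromWitness (∈∧∉⇒≢ x∈p ∉⊥) , fromWitness (∈∧∉⇒≢ ∈⊤ y∉p ∘ sym)

  Proper⇒Nonempty : ∀ {p : Subset n} → Proper p → Nonempty p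
  Proper⇒Nonempty (≢∅ , _) = ≢∅⇒Nonempty (toWitness ≢∅)

  Proper⇒∃∉ : ∀ {p : Subset n} → Proper p → ∃ (_∉ p)
  Proper⇒∃∉ (_ , ≢full) = ≢full⇒∃∉ (toWitness ≢full)

  Proper∧Disjoint⇒≢ : ∀ {p q : Subset n} → Proper p → Disjoint p q → p ≢ q
  Proper∧Disjoint⇒≢ proper p#q =
    let x , x∈p = Proper⇒Nonempty proper in ∈∧∉⇒≢ x∈p (p#q x∈p)

  ∁-Proper : ∀ {p : Subset n} → Proper p → Proper (∁ p)
  ∁-Proper proper =
    let x , x∈p = Proper⇒Nonempty proper
        y , y∉p = Proper⇒∃∉ proper
    in ∈∧∉⇒Proper (x∉p⇒x∈∁p y∉p) (x∈p⇒x∉∁p x∈p)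

  ∩-Proper : ∀ {x} {p q : Subset n} → x ∈ p → x ∈ q → Proper p → Proper (p ∩ q)
  ∩-Proper {p = p} {q} x∈p x∈q proper =
    let y , y∉p = Proper⇒∃∉ proper
    in ∈∧∉⇒Proper (x∈p∩q⁺ (x∈p , x∈q)) (y∉p ∘ p∩q⊆p p q)

  ⁅⁆-Proper : ∀ {x y : Fin n} → y ≢ x → Proper ⁅ x ⁆
  ⁅⁆-Proper {x} y≢x = ∈∧∉⇒Proper (x∈⁅x⁆ x) (x≢y⇒x∉⁅y⁆ y≢x)

  pair-Proper : 3 ≤ n → (x y : Fin n) → Proper (⁅ x ⁆ ∪ ⁅ y ⁆)
  pair-Proper n≥3 x y with ∃≢₂ n≥3 x y
  ... | z , z≢x , z≢y = ∈∧∉⇒Proper (x∈p∪q⁺ (inj₁ (x∈⁅x⁆ x)))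
    ([ z≢x ∘ x∈⁅y⁆⇒x≡y x , z≢y ∘ x∈⁅y⁆⇒x≡y y ] ∘ x∈p∪q⁻ ⁅ x ⁆ ⁅ y ⁆)

module _ {n : ℕ} {k : Subset n → ℕ} where

  ≤B-refl : ∀ {x : BlowUp n k} → x ≤B x
  ≤B-refl {bot}       = bot≤
  ≤B-refl {top}       = ≤top
  ≤B-refl {mid _ _ _} = chain≤ ≤-refl

  mid≤B-mid⇒⊆ : ∀ {a b p q i j} → mid {n} {k} a p i ≤B mid b q j → a ⊆ b
  mid≤B-mid⇒⊆ (chain≤ _)        = id
  mid≤B-mid⇒⊆ (lower≤ (a⊆b , _)) = a⊆b

  ⊆⇒mid₀≤B-mid : ∀ {a b} (p : Proper a) {q j} → a ⊆ b → mid {n} {k} a p zero ≤B mid b q j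
  ⊆⇒mid₀≤B-mid {a} {b} _ a⊆b with ≡-dec B._≟_ a b
  ... | yes refl = chain≤ z≤n
  ... | no a≢b   = lower≤ (⊆∧≢⇒⊂ a⊆b a≢b)

  Disjoint⇒MeetZero : ∀ {a b p q i j} → Disjoint a b → MeetZero {n} {k} (mid a p i) (mid b q j)
  Disjoint⇒MeetZero a#b bot _ _ = refl
  Disjoint⇒MeetZero a#b (mid c r _) c≤a c≤b =
    let x , x∈c = Proper⇒Nonempty r
    in ⊥-elim (a#b (mid≤B-mid⇒⊆ c≤a x∈c) (mid≤B-mid⇒⊆ c≤b x∈c))

  common⇒¬MeetZero : ∀ {x a b p q i j} → x ∈ a → x ∈ b → ¬ MeetZero {n} {k} (mid a p i) (mid b q j)
  common⇒¬MeetZero {a = a} {b} {p} x∈a x∈b a∧b≡0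
    with a∧b≡0 (mid (a ∩ b) (∩-Proper x∈a x∈b p) zero)
               (⊆⇒mid₀≤B-mid _ (p∩q⊆p a b)) (⊆⇒mid₀≤B-mid _ (p∩q⊆q a b))
  ... | ()

  ¬MeetZero⇒common : ∀ {a b p q i j} → ¬ MeetZero {n} {k} (mid a p i) (mid b q j) →
                     ∃ λ x → x ∈ a × x ∈ b
  ¬MeetZero⇒common {a} {b} a∧b≢0 with intersect-or-disjoint a b
  ... | inj₁ common = common
  ... | inj₂ a#b    = ⊥-elim (a∧b≢0 (Disjoint⇒MeetZero a#b))

  mid-Zstar : ∀ {a p i} → Zstar {n} {k} (mid a p i)
  mid-Zstar {a} {p} = (λ ()) , mid (∁ a) (∁-Proper p) zero , (λ ()) , Disjoint⇒MeetZero Disjoint-∁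

  data IsMid : BlowUp n k → Set where
    isMid : ∀ {a p i} → IsMid (mid a p i)

  Zstar⇒IsMid : ∀ {x} → Zstar x → IsMid x
  Zstar⇒IsMid {bot} (bot≢bot , _)             = ⊥-elim (bot≢bot refl)
  Zstar⇒IsMid {top} (_ , y , y≢bot , top∧y≡0) = ⊥-elim (y≢bot (top∧y≡0 y ≤top ≤B-refl))
  Zstar⇒IsMid {mid _ _ _} _                   = isMid

  common⇒AdjGc : ∀ {x a b p q i j} → x ∈ a → x ∈ b → a ≢ b → AdjGc {n} {k} (mid a p i) (mid b q j)
  common⇒AdjGc x∈a x∈b a≢b =
    mid-Zstar , mid-Zstar , (λ { refl → a≢b refl }) , common⇒¬MeetZero x∈a x∈b

  Disjoint⇒2≤walk : ∀ {a b p q i j d} → Disjoint a b →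
                    Walk AdjGc (mid {n} {k} a p i) (mid b q j) d → 2 ≤ d
  Disjoint⇒2≤walk {p = p} a#b here = ⊥-elim (Proper∧Disjoint⇒≢ p a#b refl)
  Disjoint⇒2≤walk a#b (step (_ , _ , _ , a∧b≢0) here) = ⊥-elim (a∧b≢0 (Disjoint⇒MeetZero a#b))
  Disjoint⇒2≤walk a#b (step _ (step _ _))            = s≤s (s≤s z≤n)

  Disjoint⇒neighbours-within-2 : ∀ {a b p q i j} → 3 ≤ n → Disjoint a b →
    ∀ w → AdjGc (mid {n} {k} a p i) w → Σ ℕ λ l → l ≤ 2 × Walk AdjGc (mid b q j) w l
  Disjoint⇒neighbours-within-2 {b = b} {q = q} n≥3 a#b w (_ , w∈Z* , _ , a∧w≢0)
    with Zstar⇒IsMid w∈Z*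
  ... | isMid {c} with ¬MeetZero⇒common a∧w≢0 | Proper⇒Nonempty q | intersect-or-disjoint b c
  ...   | x , x∈a , x∈c | _ | inj₁ (z , z∈b , z∈c) =
          1 , s≤s z≤n , step (common⇒AdjGc z∈b z∈c (∈∧∉⇒≢ x∈c (a#b x∈a) ∘ sym)) here
  ...   | x , x∈a , x∈c | y , y∈b | inj₂ b#c =
          2 , ≤-refl ,
          step (common⇒AdjGc {q = pair-Proper n≥3 y x} {j = zero}
                  y∈b y∈link (∈∧∉⇒≢ x∈link (a#b x∈a) ∘ sym))
          (step (common⇒AdjGc x∈link x∈c (∈∧∉⇒≢ y∈link (b#c y∈b))) here)
    where
    link : Subset n
    link = ⁅ y ⁆ ∪ ⁅ x ⁆
    y∈link : y ∈ link
    y∈link = x∈p∪q⁺ (inj₁ (x∈⁅x⁆ y))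
    x∈link : x ∈ link
    x∈link = x∈p∪q⁺ (inj₂ (x∈⁅x⁆ x))

  Disjoint⇒MaxDist : ∀ {a b p q i j} → 3 ≤ n → Disjoint a b →
                     MaxDist AdjGc (mid {n} {k} a p i) (mid b q j)
  Disjoint⇒MaxDist n≥3 a#b =
    maxDist-if-neighbours-within 2 (λ _ → Disjoint⇒2≤walk a#b)
      (Disjoint⇒neighbours-within-2 n≥3 a#b)

  Disjoint⇒MMD : ∀ {a b p q i j} → 3 ≤ n → Disjoint a b → MMD AdjGc (mid {n} {k} a p i) (mid b q j)
  Disjoint⇒MMD n≥3 a#b = Disjoint⇒MaxDist n≥3 a#b , Disjoint⇒MaxDist n≥3 (Disjoint-sym a#b)

  Disjoint⇒AdjSR : ∀ {a b p q i j} → 3 ≤ n → Disjoint a b → AdjSR (mid {n} {k} a p i) (mid b q j)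
  Disjoint⇒AdjSR {a} {b} {p} {q} {i} {j} n≥3 a#b =
    (mid-Zstar , mid b q j , mid-Zstar , Disjoint⇒MMD n≥3 a#b) ,
    (mid-Zstar , mid a p i , mid-Zstar , Disjoint⇒MMD n≥3 (Disjoint-sym a#b)) ,
    (λ { refl → Proper∧Disjoint⇒≢ p a#b refl }) ,
    Disjoint⇒MMD n≥3 a#b

  mids-within-3-in-SR : ∀ {a b p q i j} → 3 ≤ n →
                        Σ ℕ λ m → m ≤ 3 × Walk AdjSR (mid {n} {k} a p i) (mid b q j) m
  mids-within-3-in-SR {a} {b} {p} {q} n≥3 with intersect-or-disjoint a b
  ... | inj₂ a#b = 1 , s≤s z≤n , step (Disjoint⇒AdjSR n≥3 a#b) here
  ... | inj₁ (x , x∈a , _) with intersect-or-disjoint (∁ a) (∁ b)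
  ...   | inj₁ (r , r∈∁a , r∈∁b) =
          2 , s≤s (s≤s z≤n) ,
          step (Disjoint⇒AdjSR {q = ⁅⁆-Proper x≢r} {j = zero} n≥3
                  (Disjoint-sym (∉⇒Disjoint-⁅⁆ (x∈∁p⇒x∉p r∈∁a))))
          (step (Disjoint⇒AdjSR n≥3 (∉⇒Disjoint-⁅⁆ (x∈∁p⇒x∉p r∈∁b))) here)
    where
    x≢r : x ≢ r
    x≢r refl = x∈∁p⇒x∉p r∈∁a x∈a
  ...   | inj₂ ∁a#∁b =
          3 , ≤-refl ,
          step (Disjoint⇒AdjSR {q = ∁-Proper p} {j = zero} n≥3 Disjoint-∁)
          (step (Disjoint⇒AdjSR {q = ∁-Proper q} {j = zero} n≥3 ∁a#∁b)
          (step (Disjoint⇒AdjSR n≥3 (Disjoint-sym Disjoint-∁)) here))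

lemma3p18 : (n : ℕ) → 3 ≤ n → (k : Subset n → ℕ) →
    ∀ (u v : BlowUp n k) → Boundary u → Boundary v →
    Σ ℕ (λ m → m ≤ 3 × Walk AdjSR u v m)
lemma3p18 n n≥3 k u v (u∈Z* , _) (v∈Z* , _) with Zstar⇒IsMid u∈Z* | Zstar⇒IsMid v∈Z*
... | isMid | isMid = mids-within-3-in-SR n≥3
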